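{- The relation $\le_s$ induced by a section $s$ is not necessarily transitive: there exists a section $s\colon M(\mathbb{N})\to L(\mathbb{N})$ of $q\colon L(\mathbb{N})\to M(\mathbb{N})$ such that $\le_s$ is not transitive.
   Context: $L(A)$ is the free monoid on $A$ (finite lists), $M(A)$ the free commutative monoid (finite multisets) with generators $\eta_A$, $\langle x,y\rangle=\eta_A(x)\cdot\eta_A(y)$, and $q$ the monoid homomorphism extending $\eta_A$. A section is $s$ with $q\circ s=\mathrm{id}$. $\mathrm{head}\colon L(A)\to 1+A$ returns $\mathrm{inl}(\ast)$ on the empty list and $\mathrm{inr}(x)$ on $x::xs$. $x\le_s y$ means $\mathrm{head}(s(\langle x,y\rangle))=\mathrm{inr}(x)$. -}

module Defs where

open import Data.Nat using (ℕ)
open import Data.List using (List; []; _∷_; _++_; [_])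
open import Data.Unit using (⊤; tt)
open import Data.Sum using (_⊎_; inj₁; inj₂)
open import Relation.Binary.PropositionalEquality using (_≡_)
open import Data.List.Relation.Binary.Permutation.Propositional using (_↭_)

L : Set → Set
L A = List A

-- M(A): the free commutative monoid on A (finite multisets).  Without
-- quotient types we present it as the setoid (List A, _↭_): a multiset is
-- represented by any list enumerating it, two lists denoting the same
-- multiset iff they are permutations of each other.  The monoid operation
-- is _++_ (well defined up to _↭_), the unit is [].
M : Set → Set
M A = List A

_≈M_ : {A : Set} → M A → M A → Set
_≈M_ = _↭_

ηM : {A : Set} → A → M A
ηM x = [ x ]

⟨_,_⟩ : {A : Set} → A → A → M A
⟨ x , y ⟩ = ηM x ++ ηM y

-- q : L(A) → M(A), the monoid homomorphism extending η_A.  On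
-- representatives it sends a list to (the class of) itself.
q : {A : Set} → L A → M A
q xs = xs

-- A section of q: a map s : M(A) → L(A) (so it must respect the equality
-- of M(A), i.e. be invariant under permutations of the representative)
-- with q ∘ s = id in M(A).
record Section (A : Set) : Set where
  field
    s          : M A → L A
    s-wd       : ∀ {m m′ : M A} → m ≈M m′ → s m ≡ s m′
    s-section  : ∀ (m : M A) → q (s m) ≈M m

head : {A : Set} → L A → ⊤ ⊎ A
head []       = inj₁ tt
head (x ∷ _)  = inj₂ x

_≤[_]_ : {A : Set} → A → Section A → A → Set
x ≤[ S ] y = head (Section.s S ⟨ x , y ⟩) ≡ inj₂ x

-- Sorting is a section of q whose relation ≤_s is the usual order, hence
-- transitive.  But a section may enumerate any single multiset in any order
-- it likes: listing ⟨0,2⟩ as 2 ∷ 0 ∷ [] keeps 0 ≤_s 1 and 1 ≤_s 2 while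
-- breaking 0 ≤_s 2.
module Submission where

open import Defs
open import Data.Nat using (ℕ; _≟_)
open import Data.Nat.Properties using (≤-decTotalOrder)
open import Data.List using (List; []; _∷_)
open import Data.List.Properties using (≡-dec)
open import Data.List.Relation.Binary.Permutation.Propositional
open import Data.List.Relation.Binary.Pointwise using (Pointwise-≡⇒≡)
open import Data.List.Relation.Unary.Sorted.TotalOrder.Properties using (↗↭↗⇒≋)
open import Data.List.Sort.InsertionSort ≤-decTotalOrder using (sort)
open import Data.List.Sort.InsertionSort.Properties ≤-decTotalOrder using (sort-↭; sort-↗)
open import Data.Product using (Σ; _,_)
open import Relation.Binary.Bundles using (DecTotalOrder)
open import Relation.Binary.Definitions using (Transitive)
open import Relation.Binary.PropositionalEquality using (_≡_; refl; cong)
open import Relation.Nullary using (¬_; yes; no)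

sort-↭⇒≡ : ∀ {xs ys : List ℕ} → xs ↭ ys → sort xs ≡ sort ys
sort-↭⇒≡ {xs} {ys} xs↭ys =
  Pointwise-≡⇒≡ (↗↭↗⇒≋ (DecTotalOrder.totalOrder ≤-decTotalOrder)
    (sort-↗ xs) (sort-↗ ys) (↭⇒↭ₛ sort-xs↭sort-ys))
  where
  sort-xs↭sort-ys : sort xs ↭ sort ys
  sort-xs↭sort-ys = ↭-trans (sort-↭ xs) (↭-trans xs↭ys (↭-sym (sort-↭ ys)))

sortSection : Section ℕ
sortSection = record
  { s         = sort
  ; s-wd      = sort-↭⇒≡
  ; s-section = sort-↭
  }

reorderSection : {A : Set} (S : Section A) (f : L A → L A) →
                 (∀ xs → f xs ↭ xs) → Section A
reorderSection S f f↭ = record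
  { s         = λ m → f (s m)
  ; s-wd      = λ m≈m′ → cong f (s-wd m≈m′)
  ; s-section = λ m → ↭-trans (f↭ (s m)) (s-section m)
  }
  where open Section S

swap-0∷2 : List ℕ → List ℕ
swap-0∷2 xs with ≡-dec _≟_ xs (0 ∷ 2 ∷ [])
... | yes _ = 2 ∷ 0 ∷ []
... | no  _ = xs

swap-0∷2-↭ : ∀ xs → swap-0∷2 xs ↭ xs
swap-0∷2-↭ xs with ≡-dec _≟_ xs (0 ∷ 2 ∷ [])
... | yes refl = swap 2 0 refl
... | no  _    = refl

proposition56 : Σ (Section ℕ) (λ S → ¬ Transitive (λ x y → x ≤[ S ] y))
proposition56 = S , λ ≤-trans → 0≰2 (≤-trans {0} {1} {2} 0≤1 1≤2)
  where
  S : Section ℕ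
  S = reorderSection sortSection swap-0∷2 swap-0∷2-↭

  0≤1 : 0 ≤[ S ] 1
  0≤1 = refl

  1≤2 : 1 ≤[ S ] 2
  1≤2 = refl

  0≰2 : ¬ 0 ≤[ S ] 2
  0≰2 ()
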